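{- For every positive integer $n$, \[ 2\sum_{k = 1}^n \binom{2n - 1}{2k - 1}F_{2k - 1} = \begin{cases} F_{2n - 1} L_{n - 1} L_n , & \text{$n$ odd;}\\ 5F_{2n - 1} F_{n - 1} F_n, & \text{$n$ even,} \end{cases} \qquad 2\sum_{k = 1}^n \binom{2n - 1}{2k - 1}L_{2k - 1} = L_{4n - 2} - L_{2n - 1}. \]
   Context: The Fibonacci numbers $F_j$ and Lucas numbers $L_j$ are defined for all integers $j$ by $F_0=0$, $F_1=1$, $L_0=2$, $L_1=1$, $F_j=F_{j-1}+F_{j-2}$, $L_j=L_{j-1}+L_{j-2}$, with $F_{ -j}=(-1)^{j-1}F_j$ and $L_{ -j}=(-1)^jL_j$. -}

module Defs where

open import Data.Nat using (ℕ; zero; suc; _+_; _*_; _∸_)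
open import Data.Integer using (ℤ; +_)
open import Data.List using (List; map; upTo)
open import Data.Nat.ListAction using (sum)

fib : ℕ → ℕ
fib 0 = 0
fib 1 = 1
fib (suc (suc j)) = fib (suc j) + fib j

luc : ℕ → ℕ
luc 0 = 2
luc 1 = 1
luc (suc (suc j)) = luc (suc j) + luc j

Σ₁ : ℕ → (ℕ → ℕ) → ℕ
Σ₁ n f = sum (map (λ j → f (suc j)) (upTo n))

-- Put N = 2n − 1. Since 2·[j odd] = 1 − (−1)^j, twice the sum in question is
-- Σ_j C(N,j) a_j − Σ_j C(N,j) (−1)^j a_j. For a sequence obeying the Fibonacci recurrence on
-- all of ℤ, Pascal's rule gives Σ_j C(m,j) a_j = a_{2m} and Σ_j C(m,j) (−1)^j a_j = (−1)^m a_{−m}.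
-- As N is odd, F_{−N} = F_N and L_{−N} = −L_N, so twice the sums are F_{2N} + F_N = F_N (L_N + 1)
-- and L_{2N} − L_N. Finally L_N + 1 is L_{n−1} L_n for odd n and 5 F_{n−1} F_n for even n, since
-- L_k L_{k+1} = L_{2k+1} + (−1)^k and 5 F_k F_{k+1} = L_{2k+1} − (−1)^k by the addition formula
-- and Cassini's identity.

module Submission where

open import Defs
open import Data.Nat as ℕ using (ℕ; zero; suc)
open import Data.Nat.Combinatorics using (_C_)
open import Relation.Binary.PropositionalEquality
  using (_≡_; refl; sym; trans; cong; cong₂; module ≡-Reasoning)

module BinomialSums where

  open import Data.Integer using (ℤ; +_; 0ℤ; 1ℤ; -1ℤ; _+_; _*_; _-_; _^_)
  open import Data.Integer.Properties
    using ( pos-+; +-comm; +-assoc; +-identityʳ; *-identityˡ; *-zeroʳ; *-distribˡ-+; *-distribʳ-+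
          ; -1*i≡-i; ^-*-assoc; ^-zeroˡ; +-commutativeSemigroup; *-commutativeSemigroup)
  open import Algebra.Properties.CommutativeSemigroup +-commutativeSemigroup
    using () renaming (interchange to +-interchange)
  open import Algebra.Properties.CommutativeSemigroup *-commutativeSemigroup using (x∙yz≈y∙xz)
  open import Data.Integer.Tactic.RingSolver using (solve-∀)
  import Data.Nat.Properties as ℕ
  open import Data.Nat.Combinatorics using (k>n⇒nCk≡0; nCk+nC[k+1]≡[n+1]C[k+1])
  open import Data.List using (map; applyUpTo)
  open import Data.Nat.ListAction using (sum)
  open ≡-Reasoning

  ∑< : ℕ → (ℕ → ℤ) → ℤ
  ∑< zero    f = 0ℤ
  ∑< (suc n) f = f 0 + ∑< n (λ j → f (suc j))

  syntax ∑< n (λ j → e) = ∑[ j < n ] e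

  ∑-cong : ∀ n {f g : ℕ → ℤ} → (∀ j → f j ≡ g j) → ∑< n f ≡ ∑< n g
  ∑-cong zero    f≗g = refl
  ∑-cong (suc n) f≗g = cong₂ _+_ (f≗g 0) (∑-cong n (λ j → f≗g (suc j)))

  ∑-distrib-+ : ∀ n (f g : ℕ → ℤ) → ∑[ j < n ] (f j + g j) ≡ ∑< n f + ∑< n g
  ∑-distrib-+ zero    f g = refl
  ∑-distrib-+ (suc n) f g = begin
    (f 0 + g 0) + ∑[ j < n ] (f (suc j) + g (suc j))
      ≡⟨ cong (_+_ (f 0 + g 0)) (∑-distrib-+ n _ _) ⟩
    (f 0 + g 0) + (∑[ j < n ] f (suc j) + ∑[ j < n ] g (suc j))
      ≡⟨ +-interchange (f 0) (g 0) _ _ ⟩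
    (f 0 + ∑[ j < n ] f (suc j)) + (g 0 + ∑[ j < n ] g (suc j)) ∎

  *-distribˡ-∑ : ∀ n c (f : ℕ → ℤ) → ∑[ j < n ] (c * f j) ≡ c * ∑< n f
  *-distribˡ-∑ zero    c f = sym (*-zeroʳ c)
  *-distribˡ-∑ (suc n) c f = begin
    c * f 0 + ∑[ j < n ] (c * f (suc j)) ≡⟨ cong (_+_ (c * f 0)) (*-distribˡ-∑ n c _) ⟩
    c * f 0 + c * ∑[ j < n ] f (suc j)   ≡⟨ *-distribˡ-+ c (f 0) _ ⟨
    c * (f 0 + ∑[ j < n ] f (suc j))     ∎

  ∑-last : ∀ n (f : ℕ → ℤ) → ∑< (suc n) f ≡ ∑< n f + f n
  ∑-last zero    f = +-comm (f 0) 0ℤ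
  ∑-last (suc n) f = begin
    f 0 + ∑< (suc n) (λ j → f (suc j))   ≡⟨ cong (_+_ (f 0)) (∑-last n _) ⟩
    f 0 + (∑[ j < n ] f (suc j) + f (suc n)) ≡⟨ +-assoc (f 0) _ _ ⟨
    f 0 + ∑[ j < n ] f (suc j) + f (suc n) ∎

  ∑-pairs : ∀ n (f : ℕ → ℤ) → ∑< (2 ℕ.* n) f ≡ ∑[ i < n ] (f (2 ℕ.* i) + f (suc (2 ℕ.* i)))
  ∑-pairs zero    f = refl
  ∑-pairs (suc n) f = begin
    ∑< (2 ℕ.* suc n) f
      ≡⟨ cong (λ m → ∑< m f) (ℕ.*-suc 2 n) ⟩
    f 0 + (f 1 + ∑[ j < 2 ℕ.* n ] f (2 ℕ.+ j))
      ≡⟨ cong (λ s → f 0 + (f 1 + s)) (∑-pairs n _) ⟩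
    f 0 + (f 1 + ∑[ i < n ] (f (2 ℕ.+ 2 ℕ.* i) + f (3 ℕ.+ 2 ℕ.* i)))
      ≡⟨ +-assoc (f 0) (f 1) _ ⟨
    (f 0 + f 1) + ∑[ i < n ] (f (2 ℕ.+ 2 ℕ.* i) + f (3 ℕ.+ 2 ℕ.* i))
      ≡⟨ cong (_+_ (f 0 + f 1)) (∑-cong n (λ i → cong (λ m → f m + f (suc m)) (ℕ.*-suc 2 i))) ⟨
    (f 0 + f 1) + ∑[ i < n ] (f (2 ℕ.* suc i) + f (suc (2 ℕ.* suc i))) ∎

  pos-Σ₁ : ∀ n (a : ℕ → ℕ) → + Σ₁ n a ≡ ∑[ i < n ] (+ a (suc i))
  pos-Σ₁ n a = pos-sum-applyUpTo n (λ i → i)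
    where
    pos-sum-applyUpTo : ∀ n (g : ℕ → ℕ) →
      + sum (map (λ j → a (suc j)) (applyUpTo g n)) ≡ ∑[ i < n ] (+ a (suc (g i)))
    pos-sum-applyUpTo zero    g = refl
    pos-sum-applyUpTo (suc n) g =
      trans (pos-+ (a (suc (g 0))) _) (cong (_+_ (+ a (suc (g 0)))) (pos-sum-applyUpTo n (λ i → g (suc i))))

  -1^[2*i]≡1 : ∀ i → -1ℤ ^ (2 ℕ.* i) ≡ 1ℤ
  -1^[2*i]≡1 i = trans (sym (^-*-assoc -1ℤ 2 i)) (^-zeroˡ i)

  ∑-odd-terms : ∀ n (h : ℕ → ℤ) →
    ∑[ j < 2 ℕ.* n ] ((1ℤ - -1ℤ ^ j) * h j) ≡ + 2 * ∑[ i < n ] h (suc (2 ℕ.* i))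
  ∑-odd-terms n h = begin
    ∑[ j < 2 ℕ.* n ] ((1ℤ - -1ℤ ^ j) * h j)
      ≡⟨ ∑-pairs n _ ⟩
    ∑[ i < n ] ((1ℤ - -1ℤ ^ (2 ℕ.* i)) * h (2 ℕ.* i) + (1ℤ - -1ℤ * -1ℤ ^ (2 ℕ.* i)) * h (suc (2 ℕ.* i)))
      ≡⟨ ∑-cong n (λ i → cong (λ s → (1ℤ - s) * h (2 ℕ.* i) + (1ℤ - -1ℤ * s) * h (suc (2 ℕ.* i)))
                              (-1^[2*i]≡1 i)) ⟩
    ∑[ i < n ] ((1ℤ - 1ℤ) * h (2 ℕ.* i) + (1ℤ - -1ℤ * 1ℤ) * h (suc (2 ℕ.* i)))
      ≡⟨ ∑-cong n (λ i → only-odd-survive (h (2 ℕ.* i)) (h (suc (2 ℕ.* i)))) ⟩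
    ∑[ i < n ] (+ 2 * h (suc (2 ℕ.* i)))
      ≡⟨ *-distribˡ-∑ n (+ 2) _ ⟩
    + 2 * ∑[ i < n ] h (suc (2 ℕ.* i)) ∎
    where
    only-odd-survive : ∀ a b → (1ℤ - 1ℤ) * a + (1ℤ - -1ℤ * 1ℤ) * b ≡ + 2 * b
    only-odd-survive = solve-∀

  binomial : ℕ → (ℕ → ℤ) → ℤ
  binomial m f = ∑[ j < suc m ] (+ (m C j) * f j)

  binomial-zero : ∀ (f : ℕ → ℤ) → binomial 0 f ≡ f 0
  binomial-zero f = trans (+-identityʳ _) (*-identityˡ (f 0))

  binomial-pascal : ∀ m (f : ℕ → ℤ) → binomial (suc m) f ≡ binomial m f + binomial m (λ j → f (suc j))
  binomial-pascal m f = begin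
    + 1 * f 0 + ∑[ j < suc m ] (+ (suc m C suc j) * f (suc j))
      ≡⟨ cong₂ _+_ (*-identityˡ (f 0)) (∑-cong (suc m) split) ⟩
    f 0 + ∑[ j < suc m ] (+ (m C j) * f (suc j) + + (m C suc j) * f (suc j))
      ≡⟨ cong (_+_ (f 0)) (∑-distrib-+ (suc m) (λ j → + (m C j) * f (suc j))
                                                (λ j → + (m C suc j) * f (suc j))) ⟩
    f 0 + (X + ∑[ j < suc m ] (+ (m C suc j) * f (suc j)))
      ≡⟨ cong (λ s → f 0 + (X + s)) (∑-last m (λ j → + (m C suc j) * f (suc j))) ⟩
    f 0 + (X + (Y + + (m C suc m) * f (suc m)))
      ≡⟨ cong (λ c → f 0 + (X + (Y + + c * f (suc m)))) (k>n⇒nCk≡0 (ℕ.n<1+n m)) ⟩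
    f 0 + (X + (Y + 0ℤ * f (suc m)))
      ≡⟨ rearrange (f 0) X Y (f (suc m)) ⟩
    (f 0 + Y) + X
      ≡⟨ cong (λ a → a + Y + X) (*-identityˡ (f 0)) ⟨
    binomial m f + binomial m (λ j → f (suc j)) ∎
    where
    X = binomial m (λ j → f (suc j))
    Y = ∑[ j < m ] (+ (m C suc j) * f (suc j))
    split : ∀ j → + (suc m C suc j) * f (suc j) ≡ + (m C j) * f (suc j) + + (m C suc j) * f (suc j)
    split j = begin
      + (suc m C suc j) * f (suc j)          ≡⟨ cong (λ c → + c * f (suc j)) (nCk+nC[k+1]≡[n+1]C[k+1] m j) ⟨
      + (m C j ℕ.+ m C suc j) * f (suc j)     ≡⟨ cong (_* f (suc j)) (pos-+ (m C j) (m C suc j)) ⟩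
      (+ (m C j) + + (m C suc j)) * f (suc j) ≡⟨ *-distribʳ-+ (f (suc j)) (+ (m C j)) (+ (m C suc j)) ⟩
      + (m C j) * f (suc j) + + (m C suc j) * f (suc j) ∎
    rearrange : ∀ a x y z → a + (x + (y + 0ℤ * z)) ≡ a + y + x
    rearrange = solve-∀

  *-distribˡ-binomial : ∀ m c (f : ℕ → ℤ) → binomial m (λ j → c * f j) ≡ c * binomial m f
  *-distribˡ-binomial m c f =
    trans (∑-cong (suc m) (λ j → x∙yz≈y∙xz (+ (m C j)) c (f j))) (*-distribˡ-∑ (suc m) c (λ j → + (m C j) * f j))

  binomial-distrib-- : ∀ m (f g : ℕ → ℤ) → binomial m (λ j → f j - g j) ≡ binomial m f - binomial m g
  binomial-distrib-- m f g = begin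
    binomial m (λ j → f j - g j)
      ≡⟨ ∑-cong (suc m) (λ j → distrib (+ (m C j)) (f j) (g j)) ⟩
    ∑[ j < suc m ] (+ (m C j) * f j + -1ℤ * (+ (m C j) * g j))
      ≡⟨ ∑-distrib-+ (suc m) (λ j → + (m C j) * f j) (λ j → -1ℤ * (+ (m C j) * g j)) ⟩
    binomial m f + ∑[ j < suc m ] (-1ℤ * (+ (m C j) * g j))
      ≡⟨ cong (_+_ (binomial m f)) (*-distribˡ-∑ (suc m) -1ℤ (λ j → + (m C j) * g j)) ⟩
    binomial m f + -1ℤ * binomial m g
      ≡⟨ cong (_+_ (binomial m f)) (-1*i≡-i (binomial m g)) ⟩
    binomial m f - binomial m g ∎
    where
    distrib : ∀ c a b → c * (a - b) ≡ c * a + -1ℤ * (c * b)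
    distrib = solve-∀

module FibonacciLikeSequences where

  open import Data.Integer as ℤ using (ℤ; +_; -[1+_]; -1ℤ; _+_; _*_; -_; _^_)
  open import Data.Integer.Properties using (pos-+; +-comm; *-assoc)
  open import Data.Integer.Tactic.RingSolver using (solve-∀)
  import Data.Nat.Properties as ℕ
  open BinomialSums
  open ≡-Reasoning

  record FibonacciLike (f : ℤ → ℤ) : Set where
    field
      recurrence : ∀ i → f (ℤ.suc (ℤ.suc i)) ≡ f (ℤ.suc i) + f i

    shift : FibonacciLike (λ i → f (ℤ.suc i))
    shift = record { recurrence = λ i → recurrence (ℤ.suc i) }

  open FibonacciLike public

  binomial-fibonacciLike : ∀ {f} → FibonacciLike f → ∀ m → binomial m (λ j → f (+ j)) ≡ f (+ (2 ℕ.* m))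
  binomial-fibonacciLike {f} rec zero    = binomial-zero (λ j → f (+ j))
  binomial-fibonacciLike {f} rec (suc m) = begin
    binomial (suc m) (λ j → f (+ j))
      ≡⟨ binomial-pascal m (λ j → f (+ j)) ⟩
    binomial m (λ j → f (+ j)) + binomial m (λ j → f (ℤ.suc (+ j)))
      ≡⟨ cong₂ _+_ (binomial-fibonacciLike rec m) (binomial-fibonacciLike (shift rec) m) ⟩
    f (+ (2 ℕ.* m)) + f (ℤ.suc (+ (2 ℕ.* m)))
      ≡⟨ +-comm (f (+ (2 ℕ.* m))) _ ⟩
    f (ℤ.suc (+ (2 ℕ.* m))) + f (+ (2 ℕ.* m))
      ≡⟨ recurrence rec (+ (2 ℕ.* m)) ⟨
    f (+ (2 ℕ.+ 2 ℕ.* m))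
      ≡⟨ cong (λ n → f (+ n)) (ℕ.*-suc 2 m) ⟨
    f (+ (2 ℕ.* suc m)) ∎

  suc-[1+m]≡-m : ∀ m → ℤ.suc -[1+ m ] ≡ - + m
  suc-[1+m]≡-m zero    = refl
  suc-[1+m]≡-m (suc m) = refl

  alternating-binomial-fibonacciLike : ∀ {f} → FibonacciLike f → ∀ m →
    binomial m (λ j → -1ℤ ^ j * f (+ j)) ≡ -1ℤ ^ m * f (- + m)
  alternating-binomial-fibonacciLike {f} rec zero    = binomial-zero (λ j → -1ℤ ^ j * f (+ j))
  alternating-binomial-fibonacciLike {f} rec (suc m) = begin
    binomial (suc m) (λ j → -1ℤ ^ j * f (+ j))
      ≡⟨ binomial-pascal m (λ j → -1ℤ ^ j * f (+ j)) ⟩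
    binomial m (λ j → -1ℤ ^ j * f (+ j)) + binomial m (λ j → -1ℤ * -1ℤ ^ j * f (ℤ.suc (+ j)))
      ≡⟨ cong (_+_ (binomial m (λ j → -1ℤ ^ j * f (+ j)))) (trans
           (∑-cong (suc m) (λ j → cong (_*_ (+ (m C j))) (*-assoc -1ℤ (-1ℤ ^ j) (f (ℤ.suc (+ j))))))
           (*-distribˡ-binomial m -1ℤ (λ j → -1ℤ ^ j * f (ℤ.suc (+ j))))) ⟩
    binomial m (λ j → -1ℤ ^ j * f (+ j)) + -1ℤ * binomial m (λ j → -1ℤ ^ j * f (ℤ.suc (+ j)))
      ≡⟨ cong₂ (λ a b → a + -1ℤ * b) (alternating-binomial-fibonacciLike rec m)
           (alternating-binomial-fibonacciLike (shift rec) m) ⟩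
    -1ℤ ^ m * f (- + m) + -1ℤ * (-1ℤ ^ m * f (ℤ.suc (- + m)))
      ≡⟨ cong (λ i → -1ℤ ^ m * f i + -1ℤ * (-1ℤ ^ m * f (ℤ.suc i))) (suc-[1+m]≡-m m) ⟨
    -1ℤ ^ m * f (ℤ.suc -[1+ m ]) + -1ℤ * (-1ℤ ^ m * f (ℤ.suc (ℤ.suc -[1+ m ])))
      ≡⟨ cong (λ b → -1ℤ ^ m * f (ℤ.suc -[1+ m ]) + -1ℤ * (-1ℤ ^ m * b)) (recurrence rec -[1+ m ]) ⟩
    -1ℤ ^ m * f (ℤ.suc -[1+ m ]) + -1ℤ * (-1ℤ ^ m * (f (ℤ.suc -[1+ m ]) + f -[1+ m ]))
      ≡⟨ cancel (-1ℤ ^ m) (f (ℤ.suc -[1+ m ])) (f -[1+ m ]) ⟩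
    -1ℤ * -1ℤ ^ m * f -[1+ m ] ∎
    where
    cancel : ∀ s a b → s * a + -1ℤ * (s * (a + b)) ≡ -1ℤ * s * b
    cancel = solve-∀

  -- -[1+ n ] is −(n+1): these are F₋ⱼ = (−1)^(j−1) Fⱼ and L₋ⱼ = (−1)ʲ Lⱼ.
  fibℤ : ℤ → ℤ
  fibℤ (+ n)    = + fib n
  fibℤ -[1+ n ] = -1ℤ ^ n * + fib (suc n)

  lucℤ : ℤ → ℤ
  lucℤ (+ n)    = + luc n
  lucℤ -[1+ n ] = -1ℤ ^ suc n * + luc (suc n)

  private
    reflected-recurrence : ∀ s {a b c} → c ≡ b + a → s * a ≡ -1ℤ * s * b + -1ℤ * (-1ℤ * s) * c
    reflected-recurrence s {a} {b} refl = step s a b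
      where
      step : ∀ s a b → s * a ≡ -1ℤ * s * b + -1ℤ * (-1ℤ * s) * (b + a)
      step = solve-∀

  fibℤ-recurrence : ∀ i → fibℤ (ℤ.suc (ℤ.suc i)) ≡ fibℤ (ℤ.suc i) + fibℤ i
  fibℤ-recurrence (+ n)              = pos-+ (fib (suc n)) (fib n)
  fibℤ-recurrence -[1+ 0 ]           = refl
  fibℤ-recurrence -[1+ 1 ]           = refl
  fibℤ-recurrence -[1+ suc (suc n) ] = reflected-recurrence (-1ℤ ^ n) (fibℤ-recurrence (+ suc n))

  lucℤ-recurrence : ∀ i → lucℤ (ℤ.suc (ℤ.suc i)) ≡ lucℤ (ℤ.suc i) + lucℤ i
  lucℤ-recurrence (+ n)              = pos-+ (luc (suc n)) (luc n)
  lucℤ-recurrence -[1+ 0 ]           = refl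
  lucℤ-recurrence -[1+ 1 ]           = refl
  lucℤ-recurrence -[1+ suc (suc n) ] = reflected-recurrence (-1ℤ ^ suc n) (lucℤ-recurrence (+ suc n))

  fibℤ-fibonacciLike : FibonacciLike fibℤ
  fibℤ-fibonacciLike = record { recurrence = fibℤ-recurrence }

  lucℤ-fibonacciLike : FibonacciLike lucℤ
  lucℤ-fibonacciLike = record { recurrence = lucℤ-recurrence }

module FibonacciLucasIdentities where

  open import Data.Integer using (+_; 1ℤ; -1ℤ; _+_; _*_; _-_; _^_)
  open import Data.Integer.Tactic.RingSolver using (solve-∀)
  import Data.Nat.Properties as ℕ
  open FibonacciLikeSequences
  open ≡-Reasoning

  fibonacciLike-+ : ∀ {f} → FibonacciLike f → ∀ m n →
    f (+ (suc m ℕ.+ n)) ≡ + fib (suc m) * f (+ suc n) + + fib m * f (+ n)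
  fibonacciLike-+ {f} rec zero    n = unit (f (+ suc n)) (f (+ n))
    where
    unit : ∀ a b → a ≡ 1ℤ * a + + 0 * b
    unit = solve-∀
  fibonacciLike-+ {f} rec (suc m) n = begin
    f (+ (suc (suc m) ℕ.+ n))
      ≡⟨ cong (λ i → f (+ suc i)) (ℕ.+-suc m n) ⟨
    f (+ (suc m ℕ.+ suc n))
      ≡⟨ fibonacciLike-+ rec m (suc n) ⟩
    + fib (suc m) * f (+ suc (suc n)) + + fib m * f (+ suc n)
      ≡⟨ cong (λ a → + fib (suc m) * a + + fib m * f (+ suc n)) (recurrence rec (+ n)) ⟩
    + fib (suc m) * (f (+ suc n) + f (+ n)) + + fib m * f (+ suc n)
      ≡⟨ regroup (+ fib (suc m)) (+ fib m) (f (+ suc n)) (f (+ n)) ⟩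
    (+ fib (suc m) + + fib m) * f (+ suc n) + + fib (suc m) * f (+ n)
      ≡⟨ cong (λ c → c * f (+ suc n) + + fib (suc m) * f (+ n)) (fibℤ-recurrence (+ m)) ⟨
    + fib (suc (suc m)) * f (+ suc n) + + fib (suc m) * f (+ n) ∎
    where
    regroup : ∀ p q a b → p * (a + b) + q * a ≡ (p + q) * a + p * b
    regroup = solve-∀

  luc≡2*fib[1+k]-fib : ∀ k → + luc k ≡ + 2 * + fib (suc k) - + fib k
  luc≡2*fib[1+k]-fib 0 = refl
  luc≡2*fib[1+k]-fib 1 = refl
  luc≡2*fib[1+k]-fib (suc (suc k)) = begin
    + luc (suc (suc k))
      ≡⟨ lucℤ-recurrence (+ k) ⟩
    + luc (suc k) + + luc k
      ≡⟨ cong₂ _+_ (luc≡2*fib[1+k]-fib (suc k)) (luc≡2*fib[1+k]-fib k) ⟩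
    (+ 2 * + fib (suc (suc k)) - + fib (suc k)) + (+ 2 * + fib (suc k) - + fib k)
      ≡⟨ cong (λ a → (+ 2 * a - + fib (suc k)) + (+ 2 * + fib (suc k) - + fib k)) (fibℤ-recurrence (+ k)) ⟩
    (+ 2 * (y + x) - y) + (+ 2 * y - x)
      ≡⟨ step y x ⟩
    + 2 * ((y + x) + y) - (y + x)
      ≡⟨ cong₂ (λ a b → + 2 * a - b)
               (trans (fibℤ-recurrence (+ suc k)) (cong (_+ y) (fibℤ-recurrence (+ k))))
               (fibℤ-recurrence (+ k)) ⟨
    + 2 * + fib (suc (suc (suc k))) - + fib (suc (suc k)) ∎
    where
    x = + fib k
    y = + fib (suc k)
    step : ∀ y x → (+ 2 * (y + x) - y) + (+ 2 * y - x) ≡ + 2 * ((y + x) + y) - (y + x)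
    step = solve-∀

  cassini : ∀ k → + fib (suc k) * + fib (suc k) - + fib k * + fib (suc k) - + fib k * + fib k ≡ -1ℤ ^ k
  cassini zero    = refl
  cassini (suc k) = begin
    z * z - y * z - y * y
      ≡⟨ cong (λ z → z * z - y * z - y * y) (fibℤ-recurrence (+ k)) ⟩
    (y + x) * (y + x) - y * (y + x) - y * y
      ≡⟨ step y x ⟩
    -1ℤ * (y * y - x * y - x * x)
      ≡⟨ cong (_*_ -1ℤ) (cassini k) ⟩
    -1ℤ ^ suc k ∎
    where
    x = + fib k
    y = + fib (suc k)
    z = + fib (suc (suc k))
    step : ∀ y x → (y + x) * (y + x) - y * (y + x) - y * y ≡ -1ℤ * (y * y - x * y - x * x)
    step = solve-∀

  private
    luc[1+k]-via-fib : ∀ k → + luc (suc k) ≡ + 2 * (+ fib (suc k) + + fib k) - + fib (suc k)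
    luc[1+k]-via-fib k =
      trans (luc≡2*fib[1+k]-fib (suc k)) (cong (λ z → + 2 * z - + fib (suc k)) (fibℤ-recurrence (+ k)))

  fib-double : ∀ m → + fib (2 ℕ.* m) ≡ + fib m * + luc m
  fib-double zero    = refl
  fib-double (suc k) = begin
    + fib (2 ℕ.* suc k)
      ≡⟨ cong (λ i → + fib (suc k ℕ.+ i)) (ℕ.+-identityʳ (suc k)) ⟩
    + fib (suc k ℕ.+ suc k)
      ≡⟨ fibonacciLike-+ fibℤ-fibonacciLike k (suc k) ⟩
    y * + fib (suc (suc k)) + x * y
      ≡⟨ cong (λ z → y * z + x * y) (fibℤ-recurrence (+ k)) ⟩
    y * (y + x) + x * y
      ≡⟨ step y x ⟩
    y * (+ 2 * (y + x) - y)
      ≡⟨ cong (_*_ y) (luc[1+k]-via-fib k) ⟨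
    y * + luc (suc k) ∎
    where
    x = + fib k
    y = + fib (suc k)
    step : ∀ y x → y * (y + x) + x * y ≡ y * (+ 2 * (y + x) - y)
    step = solve-∀

  private
    luc[1+2k]-via-fib : ∀ k → + luc (suc (2 ℕ.* k))
      ≡ + fib (suc k) * (+ 2 * (+ fib (suc k) + + fib k) - + fib (suc k))
        + + fib k * (+ 2 * + fib (suc k) - + fib k)
    luc[1+2k]-via-fib k = begin
      + luc (suc (2 ℕ.* k))
        ≡⟨ cong (λ i → + luc (suc (k ℕ.+ i))) (ℕ.+-identityʳ k) ⟩
      + luc (suc k ℕ.+ k)
        ≡⟨ fibonacciLike-+ lucℤ-fibonacciLike k k ⟩
      + fib (suc k) * + luc (suc k) + + fib k * + luc k
        ≡⟨ cong₂ (λ a b → + fib (suc k) * a + + fib k * b) (luc[1+k]-via-fib k) (luc≡2*fib[1+k]-fib k) ⟩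
      + fib (suc k) * (+ 2 * (+ fib (suc k) + + fib k) - + fib (suc k))
        + + fib k * (+ 2 * + fib (suc k) - + fib k) ∎

  luc-product : ∀ k → + luc k * + luc (suc k) ≡ + luc (suc (2 ℕ.* k)) + -1ℤ ^ k
  luc-product k = begin
    + luc k * + luc (suc k)
      ≡⟨ cong₂ _*_ (luc≡2*fib[1+k]-fib k) (luc[1+k]-via-fib k) ⟩
    (+ 2 * y - x) * (+ 2 * (y + x) - y)
      ≡⟨ expand y x ⟩
    (y * (+ 2 * (y + x) - y) + x * (+ 2 * y - x)) + (y * y - x * y - x * x)
      ≡⟨ cong₂ _+_ (sym (luc[1+2k]-via-fib k)) (cassini k) ⟩
    + luc (suc (2 ℕ.* k)) + -1ℤ ^ k ∎
    where
    x = + fib k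
    y = + fib (suc k)
    expand : ∀ y x → (+ 2 * y - x) * (+ 2 * (y + x) - y)
                   ≡ (y * (+ 2 * (y + x) - y) + x * (+ 2 * y - x)) + (y * y - x * y - x * x)
    expand = solve-∀

  fib-product : ∀ k → + 5 * + fib k * + fib (suc k) ≡ + luc (suc (2 ℕ.* k)) - -1ℤ ^ k
  fib-product k = begin
    + 5 * x * y
      ≡⟨ expand y x ⟩
    (y * (+ 2 * (y + x) - y) + x * (+ 2 * y - x)) - (y * y - x * y - x * x)
      ≡⟨ cong₂ _-_ (sym (luc[1+2k]-via-fib k)) (cassini k) ⟩
    + luc (suc (2 ℕ.* k)) - -1ℤ ^ k ∎
    where
    x = + fib k
    y = + fib (suc k)
    expand : ∀ y x → + 5 * x * y
                   ≡ (y * (+ 2 * (y + x) - y) + x * (+ 2 * y - x)) - (y * y - x * y - x * x)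
    expand = solve-∀

module OddBinomialSums where

  open import Data.Nat using (_∸_)
  open import Data.Nat.Divisibility using (_∣_; divides)
  open import Data.Integer using (+_; -[1+_]; 1ℤ; -1ℤ; _+_; _*_; _-_; _^_)
  open import Data.Integer.Properties using (pos-+; pos-*; +-injective)
  open import Data.Integer.Tactic.RingSolver using (solve-∀)
  import Data.Nat.Properties as ℕ
  open import Data.Nat.Tactic.RingSolver using () renaming (solve-∀ to ℕ-solve-∀)
  open import Data.Sum using (_⊎_; inj₁; inj₂)
  open import Relation.Nullary using (¬_; contradiction)
  open BinomialSums
  open FibonacciLikeSequences
  open FibonacciLucasIdentities
  open ≡-Reasoning

  even-or-odd : ∀ k → 2 ∣ k ⊎ 2 ∣ suc k
  even-or-odd zero    = inj₁ (divides 0 refl)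
  even-or-odd (suc k) with even-or-odd k
  ... | inj₁ (divides q k≡q*2) = inj₂ (divides (suc q) (cong (λ i → suc (suc i)) k≡q*2))
  ... | inj₂ 2∣1+k             = inj₁ 2∣1+k

  -1^-even : ∀ {k} → 2 ∣ k → -1ℤ ^ k ≡ 1ℤ
  -1^-even (divides q refl) = trans (cong (-1ℤ ^_) (ℕ.*-comm q 2)) (-1^[2*i]≡1 q)

  -1^-odd : ∀ {k} → 2 ∣ suc k → -1ℤ ^ k ≡ -1ℤ
  -1^-odd {k} 2∣1+k = begin
    -1ℤ ^ k                ≡⟨ flip (-1ℤ ^ k) ⟩
    -1ℤ * -1ℤ ^ suc k      ≡⟨ cong (_*_ -1ℤ) (-1^-even 2∣1+k) ⟩
    -1ℤ * 1ℤ               ∎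
    where
    flip : ∀ s → s ≡ -1ℤ * (-1ℤ * s)
    flip = solve-∀

  oddBinomialSum : (ℕ → ℕ) → ℕ → ℕ
  oddBinomialSum a n = Σ₁ n (λ k → ((2 ℕ.* n ∸ 1) C (2 ℕ.* k ∸ 1)) ℕ.* a (2 ℕ.* k ∸ 1))

  2*[1+i]∸1≡1+2*i : ∀ i → 2 ℕ.* suc i ∸ 1 ≡ suc (2 ℕ.* i)
  2*[1+i]∸1≡1+2*i i = ℕ.+-suc i (i ℕ.+ 0)

  twice-oddBinomialSum : ∀ {f a} → FibonacciLike f → (∀ j → f (+ j) ≡ + a j) → ∀ k →
    + (2 ℕ.* oddBinomialSum a (suc k)) ≡ f (+ (2 ℕ.* suc (2 ℕ.* k))) + f -[1+ 2 ℕ.* k ]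
  twice-oddBinomialSum {f} {a} rec f≗a k = begin
    + (2 ℕ.* Σ₁ (suc k) g)
      ≡⟨ pos-* 2 (Σ₁ (suc k) g) ⟩
    + 2 * + Σ₁ (suc k) g
      ≡⟨ cong (_*_ (+ 2)) (trans (pos-Σ₁ (suc k) g) (∑-cong (suc k) odd-term)) ⟩
    + 2 * ∑[ i < suc k ] (+ (N C suc (2 ℕ.* i)) * f (+ suc (2 ℕ.* i)))
      ≡⟨ ∑-odd-terms (suc k) (λ j → + (N C j) * f (+ j)) ⟨
    ∑[ j < 2 ℕ.* suc k ] ((1ℤ - -1ℤ ^ j) * (+ (N C j) * f (+ j)))
      ≡⟨ cong (λ n → ∑[ j < n ] ((1ℤ - -1ℤ ^ j) * (+ (N C j) * f (+ j)))) (ℕ.*-suc 2 k) ⟩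
    ∑[ j < suc N ] ((1ℤ - -1ℤ ^ j) * (+ (N C j) * f (+ j)))
      ≡⟨ ∑-cong (suc N) (λ j → regroup (+ (N C j)) (-1ℤ ^ j) (f (+ j))) ⟩
    binomial N (λ j → f (+ j) - -1ℤ ^ j * f (+ j))
      ≡⟨ binomial-distrib-- N (λ j → f (+ j)) (λ j → -1ℤ ^ j * f (+ j)) ⟩
    binomial N (λ j → f (+ j)) - binomial N (λ j → -1ℤ ^ j * f (+ j))
      ≡⟨ cong₂ _-_ (binomial-fibonacciLike rec N) (alternating-binomial-fibonacciLike rec N) ⟩
    f (+ (2 ℕ.* N)) - -1ℤ * -1ℤ ^ (2 ℕ.* k) * f -[1+ 2 ℕ.* k ]
      ≡⟨ cong (λ s → f (+ (2 ℕ.* N)) - -1ℤ * s * f -[1+ 2 ℕ.* k ]) (-1^[2*i]≡1 k) ⟩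
    f (+ (2 ℕ.* N)) - -1ℤ * 1ℤ * f -[1+ 2 ℕ.* k ]
      ≡⟨ cancel (f (+ (2 ℕ.* N))) (f -[1+ 2 ℕ.* k ]) ⟩
    f (+ (2 ℕ.* N)) + f -[1+ 2 ℕ.* k ] ∎
    where
    N = suc (2 ℕ.* k)
    g : ℕ → ℕ
    g i = ((2 ℕ.* suc k ∸ 1) C (2 ℕ.* i ∸ 1)) ℕ.* a (2 ℕ.* i ∸ 1)
    odd-term : ∀ i → + g (suc i) ≡ + (N C suc (2 ℕ.* i)) * f (+ suc (2 ℕ.* i))
    odd-term i = begin
      + g (suc i)
        ≡⟨ cong₂ (λ n j → + ((n C j) ℕ.* a j)) (2*[1+i]∸1≡1+2*i k) (2*[1+i]∸1≡1+2*i i) ⟩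
      + ((N C suc (2 ℕ.* i)) ℕ.* a (suc (2 ℕ.* i)))
        ≡⟨ pos-* (N C suc (2 ℕ.* i)) (a (suc (2 ℕ.* i))) ⟩
      + (N C suc (2 ℕ.* i)) * + a (suc (2 ℕ.* i))
        ≡⟨ cong (_*_ (+ (N C suc (2 ℕ.* i)))) (f≗a (suc (2 ℕ.* i))) ⟨
      + (N C suc (2 ℕ.* i)) * f (+ suc (2 ℕ.* i)) ∎
    regroup : ∀ c s b → (1ℤ - s) * (c * b) ≡ c * (b - s * b)
    regroup = solve-∀
    cancel : ∀ a b → a - -1ℤ * 1ℤ * b ≡ a + b
    cancel = solve-∀

  4*[1+k]∸2≡2*[1+2*k] : ∀ k → 4 ℕ.* suc k ∸ 2 ≡ 2 ℕ.* suc (2 ℕ.* k)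
  4*[1+k]∸2≡2*[1+2*k] k = cong (_∸ 2) (expand k)
    where
    expand : ∀ k → 4 ℕ.* suc k ≡ 2 ℕ.+ 2 ℕ.* suc (2 ℕ.* k)
    expand = ℕ-solve-∀

  twice-oddBinomialSum-fib : ∀ k → let N = suc (2 ℕ.* k) in
    2 ℕ.* oddBinomialSum fib (suc k) ≡ fib N ℕ.* (luc N ℕ.+ 1)
  twice-oddBinomialSum-fib k = +-injective (begin
    + (2 ℕ.* oddBinomialSum fib (suc k))
      ≡⟨ twice-oddBinomialSum fibℤ-fibonacciLike (λ _ → refl) k ⟩
    + fib (2 ℕ.* N) + -1ℤ ^ (2 ℕ.* k) * + fib N
      ≡⟨ cong₂ (λ a s → a + s * + fib N) (fib-double N) (-1^[2*i]≡1 k) ⟩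
    + fib N * + luc N + 1ℤ * + fib N
      ≡⟨ factor (+ fib N) (+ luc N) ⟩
    + fib N * (+ luc N + 1ℤ)
      ≡⟨ trans (pos-* (fib N) (luc N ℕ.+ 1)) (cong (_*_ (+ fib N)) (pos-+ (luc N) 1)) ⟨
    + (fib N ℕ.* (luc N ℕ.+ 1)) ∎)
    where
    N = suc (2 ℕ.* k)
    factor : ∀ a b → a * b + 1ℤ * a ≡ a * (b + 1ℤ)
    factor = solve-∀

  twice-oddBinomialSum-fib-odd : ∀ k → ¬ 2 ∣ suc k →
    2 ℕ.* oddBinomialSum fib (suc k) ≡ fib (2 ℕ.* suc k ∸ 1) ℕ.* luc k ℕ.* luc (suc k)
  twice-oddBinomialSum-fib-odd k 2∤1+k with even-or-odd k
  ... | inj₂ 2∣1+k = contradiction 2∣1+k 2∤1+k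
  ... | inj₁ 2∣k   = begin
    2 ℕ.* oddBinomialSum fib (suc k)    ≡⟨ twice-oddBinomialSum-fib k ⟩
    fib N ℕ.* (luc N ℕ.+ 1)             ≡⟨ cong (fib N ℕ.*_) luc-product′ ⟨
    fib N ℕ.* (luc k ℕ.* luc (suc k))   ≡⟨ ℕ.*-assoc (fib N) (luc k) (luc (suc k)) ⟨
    fib N ℕ.* luc k ℕ.* luc (suc k)
      ≡⟨ cong (λ n → fib n ℕ.* luc k ℕ.* luc (suc k)) (2*[1+i]∸1≡1+2*i k) ⟨
    fib (2 ℕ.* suc k ∸ 1) ℕ.* luc k ℕ.* luc (suc k) ∎
    where
    N = suc (2 ℕ.* k)
    luc-product′ : luc k ℕ.* luc (suc k) ≡ luc N ℕ.+ 1
    luc-product′ = +-injective (begin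
      + (luc k ℕ.* luc (suc k))  ≡⟨ pos-* (luc k) (luc (suc k)) ⟩
      + luc k * + luc (suc k)    ≡⟨ luc-product k ⟩
      + luc N + -1ℤ ^ k          ≡⟨ cong (_+_ (+ luc N)) (-1^-even 2∣k) ⟩
      + luc N + 1ℤ               ≡⟨ pos-+ (luc N) 1 ⟨
      + (luc N ℕ.+ 1)            ∎)

  twice-oddBinomialSum-fib-even : ∀ k → 2 ∣ suc k →
    2 ℕ.* oddBinomialSum fib (suc k) ≡ 5 ℕ.* fib (2 ℕ.* suc k ∸ 1) ℕ.* fib k ℕ.* fib (suc k)
  twice-oddBinomialSum-fib-even k 2∣1+k = begin
    2 ℕ.* oddBinomialSum fib (suc k)                ≡⟨ twice-oddBinomialSum-fib k ⟩
    fib N ℕ.* (luc N ℕ.+ 1)                         ≡⟨ cong (fib N ℕ.*_) fib-product′ ⟨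
    fib N ℕ.* (5 ℕ.* fib k ℕ.* fib (suc k))         ≡⟨ regroup (fib N) (fib k) (fib (suc k)) ⟩
    5 ℕ.* fib N ℕ.* fib k ℕ.* fib (suc k)
      ≡⟨ cong (λ n → 5 ℕ.* fib n ℕ.* fib k ℕ.* fib (suc k)) (2*[1+i]∸1≡1+2*i k) ⟨
    5 ℕ.* fib (2 ℕ.* suc k ∸ 1) ℕ.* fib k ℕ.* fib (suc k) ∎
    where
    N = suc (2 ℕ.* k)
    regroup : ∀ a b c → a ℕ.* (5 ℕ.* b ℕ.* c) ≡ 5 ℕ.* a ℕ.* b ℕ.* c
    regroup = ℕ-solve-∀
    minus-minus : ∀ a → a - -1ℤ ≡ a + 1ℤ
    minus-minus = solve-∀
    fib-product′ : 5 ℕ.* fib k ℕ.* fib (suc k) ≡ luc N ℕ.+ 1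
    fib-product′ = +-injective (begin
      + (5 ℕ.* fib k ℕ.* fib (suc k))
        ≡⟨ trans (pos-* (5 ℕ.* fib k) (fib (suc k))) (cong (_* + fib (suc k)) (pos-* 5 (fib k))) ⟩
      + 5 * + fib k * + fib (suc k)    ≡⟨ fib-product k ⟩
      + luc N - -1ℤ ^ k                ≡⟨ cong (_-_ (+ luc N)) (-1^-odd 2∣1+k) ⟩
      + luc N - -1ℤ                    ≡⟨ minus-minus (+ luc N) ⟩
      + luc N + 1ℤ                     ≡⟨ pos-+ (luc N) 1 ⟨
      + (luc N ℕ.+ 1)                  ∎)

  twice-oddBinomialSum-luc : ∀ k →
    + (2 ℕ.* oddBinomialSum luc (suc k)) ≡ + luc (4 ℕ.* suc k ∸ 2) - + luc (2 ℕ.* suc k ∸ 1)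
  twice-oddBinomialSum-luc k = begin
    + (2 ℕ.* oddBinomialSum luc (suc k))
      ≡⟨ twice-oddBinomialSum lucℤ-fibonacciLike (λ _ → refl) k ⟩
    + luc (2 ℕ.* N) + -1ℤ * -1ℤ ^ (2 ℕ.* k) * + luc N
      ≡⟨ cong (λ s → + luc (2 ℕ.* N) + -1ℤ * s * + luc N) (-1^[2*i]≡1 k) ⟩
    + luc (2 ℕ.* N) + -1ℤ * 1ℤ * + luc N
      ≡⟨ negate (+ luc (2 ℕ.* N)) (+ luc N) ⟩
    + luc (2 ℕ.* N) - + luc N
      ≡⟨ cong₂ (λ m n → + luc m - + luc n) (4*[1+k]∸2≡2*[1+2*k] k) (2*[1+i]∸1≡1+2*i k) ⟨
    + luc (4 ℕ.* suc k ∸ 2) - + luc (2 ℕ.* suc k ∸ 1) ∎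
    where
    N = suc (2 ℕ.* k)
    negate : ∀ a b → a + -1ℤ * 1ℤ * b ≡ a - b
    negate = solve-∀

open OddBinomialSums

open import Data.Nat using (_*_; _∸_; _≥_)
open import Data.Nat.Divisibility using (_∣_)
open import Data.Integer using (+_; _-_)
open import Data.Product using (_×_; _,_)
open import Relation.Nullary using (¬_)

corollary17 : (n : ℕ) → n ≥ 1 →
    ((¬ (2 ∣ n) →
        2 * Σ₁ n (λ k → ((2 * n ∸ 1) C (2 * k ∸ 1)) * fib (2 * k ∸ 1))
          ≡ fib (2 * n ∸ 1) * luc (n ∸ 1) * luc n)
     × (2 ∣ n →
        2 * Σ₁ n (λ k → ((2 * n ∸ 1) C (2 * k ∸ 1)) * fib (2 * k ∸ 1))
          ≡ 5 * fib (2 * n ∸ 1) * fib (n ∸ 1) * fib n))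
    × (+ (2 * Σ₁ n (λ k → ((2 * n ∸ 1) C (2 * k ∸ 1)) * luc (2 * k ∸ 1)))
          ≡ + luc (4 * n ∸ 2) - + luc (2 * n ∸ 1))
corollary17 zero    ()
corollary17 (suc k) _ =
  (twice-oddBinomialSum-fib-odd k , twice-oddBinomialSum-fib-even k) , twice-oddBinomialSum-luc k
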